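{- Let $m\geq 1$ and $\{G_n\}_{n=1}^\infty$ be a sensitive family. Then the family $\{\overline{K}_m \vee G_n\}_{n=1}^\infty$ is also sensitive.
   Context: All graphs are finite, undirected and simple. $\overline{K}_m$ denotes the empty (edgeless) graph on $m$ vertices and $\vee$ the join (disjoint union plus all edges between the two graphs). $\alpha(G)$ is the independence number and $\Delta(G)$ the maximum degree. The sensitivity of a nonempty graph $G=(V,E)$ is $\sigma(G)=\min\{\Delta(G[S]) : S\subseteq V,\ |S|>\alpha(G)\}$. An indexed family of graphs $G_n$ with $\Delta(G_n)\to\infty$ is sensitive if $\sigma(G_n)\to\infty$ and insensitive otherwise. -}

module Defs where

open import Data.Nat using (ℕ; zero; suc; _+_; _≤_; _<_; _⊔_; _⊓_)
open import Data.Bool using (Bool; true; false; _∧_; _∨_; not; if_then_else_)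
open import Data.Fin using (Fin; splitAt)
open import Data.Fin.Subset using (Subset; ∣_∣)
open import Data.Vec using (Vec; []; _∷_; lookup; replicate)
open import Data.List using (List; []; _∷_; map; _++_; filter; foldr; allFin)
open import Data.Sum using (_⊎_; inj₁; inj₂)
open import Data.Product using (_×_; ∃)
open import Relation.Binary.PropositionalEquality using (_≡_; refl)
open import Relation.Nullary.Decidable using (Dec)
open import Data.Nat using (_<?_)

record Graph : Set where
  field
    size   : ℕ
    adj    : Fin size → Fin size → Bool
    sym    : ∀ u v → adj u v ≡ adj v u
    irrefl : ∀ v → adj v v ≡ false
open Graph public

allSubsets : (n : ℕ) → List (Subset n)
allSubsets zero    = [] ∷ []
allSubsets (suc n) = map (true ∷_) (allSubsets n) ++ map (false ∷_) (allSubsets n)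

allB : ∀ {A : Set} → (A → Bool) → List A → Bool
allB p = foldr (λ x b → p x ∧ b) true

maxList : List ℕ → ℕ
maxList = foldr _⊔_ 0

-- minimum of a list; convention: minimum of the empty list is 0
minList : List ℕ → ℕ
minList []       = 0
minList (x ∷ xs) = foldr _⊓_ x xs

isIndependent : (G : Graph) → Subset (size G) → Bool
isIndependent G S =
  allB (λ u → allB (λ v → not (lookup S u ∧ lookup S v ∧ adj G u v)) (allFin (size G)))
       (allFin (size G))

α : Graph → ℕ
α G = maxList (map ∣_∣ (filter (λ S → Data.Bool._≟_ (isIndependent G S) true) (allSubsets (size G))))

degIn : (G : Graph) → Subset (size G) → Fin (size G) → ℕ
degIn G S v = foldr (λ u k → if lookup S u ∧ adj G v u then suc k else k) 0 (allFin (size G))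

-- Δ(G[S]) : maximum degree of the induced subgraph on S (0 if S is empty)
Δind : (G : Graph) → Subset (size G) → ℕ
Δind G S = maxList (map (λ v → if lookup S v then degIn G S v else 0) (allFin (size G)))

Δ : Graph → ℕ
Δ G = Δind G (replicate (size G) true)

-- sensitivity σ(G) = min { Δ(G[S]) : |S| > α(G) }
-- (convention: 0 when no such S exists, i.e. when G is edgeless; irrelevant below)
σ : Graph → ℕ
σ G = minList (map (Δind G) (filter (λ S → α G <? ∣ S ∣) (allSubsets (size G))))

emptyGraph : ℕ → Graph
emptyGraph m = record { size = m ; adj = λ _ _ → false ; sym = λ _ _ → refl ; irrefl = λ _ → refl }

joinAdj : (G H : Graph) → Fin (size G + size H) → Fin (size G + size H) → Bool
joinAdj G H u v with splitAt (size G) u | splitAt (size G) v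
... | inj₁ a | inj₁ b = adj G a b
... | inj₁ a | inj₂ b = true
... | inj₂ a | inj₁ b = true
... | inj₂ a | inj₂ b = adj H a b

joinSym : (G H : Graph) → ∀ u v → joinAdj G H u v ≡ joinAdj G H v u
joinSym G H u v with splitAt (size G) u | splitAt (size G) v
... | inj₁ a | inj₁ b = sym G a b
... | inj₁ a | inj₂ b = refl
... | inj₂ a | inj₁ b = refl
... | inj₂ a | inj₂ b = sym H a b

joinIrrefl : (G H : Graph) → ∀ v → joinAdj G H v v ≡ false
joinIrrefl G H v with splitAt (size G) v
... | inj₁ a = irrefl G a
... | inj₂ a = irrefl H a

_∨G_ : Graph → Graph → Graph
G ∨G H = record { size = size G + size H ; adj = joinAdj G H
                ; sym = joinSym G H ; irrefl = joinIrrefl G H }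

TendsToInfinity : (ℕ → ℕ) → Set
TendsToInfinity f = ∀ B → ∃ λ N → ∀ n → N ≤ n → B ≤ f n

-- a family is sensitive: Δ(G_n) → ∞ (standing assumption) and σ(G_n) → ∞
Sensitive : (ℕ → Graph) → Set
Sensitive G = TendsToInfinity (λ n → Δ (G n)) × TendsToInfinity (λ n → σ (G n))

-- Let H = K̄ₘ ∨ G. Then α(G) ≤ α(H), Δ(G) ≤ Δ(H) and σ(G) ≤ α(G) + 1. Split a set S
-- of more than α(H) vertices of H as A ∪ C with A ⊆ K̄ₘ and C ⊆ G; C is nonempty since
-- K̄ₘ is edgeless. If A = ∅ then |C| > α(G), so Δ(H[S]) ≥ Δ(G[C]) ≥ σ(G). Otherwise
-- every vertex of A sees all of C and vice versa, so 2 Δ(H[S]) ≥ |A| + |C| > α(H) ≥ σ(G) − 1.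
-- Hence σ(H) ≥ (σ(G) − 1) / 2, which tends to infinity with σ(G).
module Submission where

open import Defs hiding (sym)
open import Data.Nat using (ℕ; _≤_; zero; suc; _+_; _<_; _⊓_; z≤n; s≤s; _<?_)
open import Data.Nat.Properties
open import Data.Bool using (Bool; true; false; _∧_; not; if_then_else_)
import Data.Bool as Bool
open import Data.Fin using (Fin; _↑ˡ_; _↑ʳ_; splitAt) renaming (zero to fzero; suc to fsuc)
open import Data.Fin.Properties using (splitAt-↑ˡ; splitAt-↑ʳ; join-splitAt)
open import Data.Fin.Subset using (Subset; ∣_∣; ⊤; ⊥; _∩_; Nonempty)
open import Data.Fin.Subset.Properties using (∣p∣≤n; ∣⊥∣≡0; ∣⊤∣≡n; ∣p∩q∣≤∣p∣; nonempty?; Empty-unique; ∩-identityʳ)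
open import Data.Vec using ([]; _∷_; lookup; tabulate; replicate; _++_)
import Data.Vec as Vec
open import Data.Vec.Properties using (lookup-replicate; tabulate-cong; lookup-++ˡ; lookup-++ʳ; zipWith-++; []=⇒lookup)
import Data.List as List
open import Data.List using ([]; _∷_; map; filter; foldr; allFin)
open import Data.List.Membership.Propositional using (_∈_)
open import Data.List.Membership.Propositional.Properties
  using (∈-++⁺ˡ; ∈-++⁺ʳ; ∈-map⁺; ∈-map⁻; ∈-map∘filter⁺; ∈-map∘filter⁻; ∈-allFin)
open import Data.List.Relation.Unary.Any using (here; there)
open import Data.Product using (∃; _×_; _,_)
open import Data.Sum using (inj₁; inj₂)
open import Function using (_∘_)
open import Relation.Binary.PropositionalEquality
open import Relation.Nullary using (yes; no; contradiction)

≤-maxList : ∀ {y} ys → y ∈ ys → y ≤ maxList ys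
≤-maxList (x ∷ ys) (here refl) = m≤m⊔n x _
≤-maxList (x ∷ ys) (there y∈ys) = m≤n⇒m≤o⊔n x (≤-maxList ys y∈ys)

maxList-≤ : ∀ {B} ys → (∀ {y} → y ∈ ys → y ≤ B) → maxList ys ≤ B
maxList-≤ []       _     = z≤n
maxList-≤ (x ∷ ys) ys≤B = ⊔-lub (ys≤B (here refl)) (maxList-≤ ys (ys≤B ∘ there))

minList-≤ : ∀ {y} ys → y ∈ ys → minList ys ≤ y
minList-≤ (x ∷ ys) (here refl) = foldr-⊓-≤-seed ys
  where
  foldr-⊓-≤-seed : ∀ zs → foldr _⊓_ x zs ≤ x
  foldr-⊓-≤-seed []       = ≤-refl
  foldr-⊓-≤-seed (z ∷ zs) = m≤n⇒o⊓m≤n z (foldr-⊓-≤-seed zs)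
minList-≤ (x ∷ ys) (there y∈ys) = foldr-⊓-≤ ys y∈ys
  where
  foldr-⊓-≤ : ∀ {y} zs → y ∈ zs → foldr _⊓_ x zs ≤ y
  foldr-⊓-≤ (z ∷ zs) (here refl)  = m⊓n≤m z _
  foldr-⊓-≤ (z ∷ zs) (there y∈zs) = m≤n⇒o⊓m≤n z (foldr-⊓-≤ zs y∈zs)

≤-minList : ∀ {B} x ys → (∀ {y} → y ∈ x ∷ ys → B ≤ y) → B ≤ minList (x ∷ ys)
≤-minList x ys B≤ = ≤-foldr-⊓ ys (B≤ ∘ there)
  where
  ≤-foldr-⊓ : ∀ zs → (∀ {y} → y ∈ zs → _ ≤ y) → _ ≤ foldr _⊓_ x zs
  ≤-foldr-⊓ []       _    = B≤ (here refl)
  ≤-foldr-⊓ (z ∷ zs) B≤zs = ⊓-glb (B≤zs (here refl)) (≤-foldr-⊓ zs (B≤zs ∘ there))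

allB-true⁻ : ∀ {A : Set} (p : A → Bool) xs → allB p xs ≡ true → ∀ {x} → x ∈ xs → p x ≡ true
allB-true⁻ p (x ∷ xs) all-p (here refl) with p x
... | true = refl
allB-true⁻ p (x ∷ xs) all-p (there x∈xs) with p x
... | true = allB-true⁻ p xs all-p x∈xs

allB-true⁺ : ∀ {A : Set} (p : A → Bool) xs → (∀ {x} → x ∈ xs → p x ≡ true) → allB p xs ≡ true
allB-true⁺ p []       _    = refl
allB-true⁺ p (x ∷ xs) p-xs rewrite p-xs (here refl) = allB-true⁺ p xs (p-xs ∘ there)

∈-allSubsets : ∀ n (S : Subset n) → S ∈ allSubsets n
∈-allSubsets zero    []          = here refl
∈-allSubsets (suc n) (true ∷ S)  = ∈-++⁺ˡ (∈-map⁺ (true ∷_) (∈-allSubsets n S))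
∈-allSubsets (suc n) (false ∷ S) =
  ∈-++⁺ʳ (map (true ∷_) (allSubsets n)) (∈-map⁺ (false ∷_) (∈-allSubsets n S))

∣++∣ : ∀ {m k} (A : Subset m) (B : Subset k) → ∣ A ++ B ∣ ≡ ∣ A ∣ + ∣ B ∣
∣++∣ []          B = refl
∣++∣ (true ∷ A)  B = cong suc (∣++∣ A B)
∣++∣ (false ∷ A) B = ∣++∣ A B

tabulate-++ : ∀ {A : Set} m {k} (f : Fin (m + k) → A) →
              tabulate f ≡ tabulate (f ∘ (_↑ˡ k)) ++ tabulate (f ∘ (m ↑ʳ_))
tabulate-++ zero    f = refl
tabulate-++ (suc m) f = cong (f fzero ∷_) (tabulate-++ m (f ∘ fsuc))

tabulate-constant : ∀ {A : Set} {n} {x : A} {f : Fin n → A} → (∀ i → f i ≡ x) → tabulate f ≡ replicate n x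
tabulate-constant {n = zero}  f≡x = refl
tabulate-constant {n = suc n} f≡x = cong₂ _∷_ (f≡x fzero) (tabulate-constant (f≡x ∘ fsuc))

∩-tabulate : ∀ {n} (S : Subset n) (g : Fin n → Bool) →
             S ∩ tabulate g ≡ tabulate (λ u → lookup S u ∧ g u)
∩-tabulate []      g = refl
∩-tabulate (x ∷ S) g = cong (x ∧ g fzero ∷_) (∩-tabulate S (g ∘ fsuc))

count-tabulate : ∀ {n N} (p : Fin N → Bool) (f : Fin n → Fin N) →
                 foldr (λ u k → if p u then suc k else k) 0 (List.tabulate f) ≡ ∣ tabulate (p ∘ f) ∣
count-tabulate {zero}  p f = refl
count-tabulate {suc n} p f with p (f fzero)
... | true  = cong suc (count-tabulate p (f ∘ fsuc))
... | false = count-tabulate p (f ∘ fsuc)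

subset-of-size : ∀ {n j} → j ≤ n → ∃ λ (T : Subset n) → ∣ T ∣ ≡ j
subset-of-size {n}     z≤n       = ⊥ , ∣⊥∣≡0 n
subset-of-size {suc n} (s≤s j≤n) with subset-of-size j≤n
... | T , ∣T∣≡j = true ∷ T , cong suc ∣T∣≡j

neighbourhood : (G : Graph) → Fin (size G) → Subset (size G)
neighbourhood G v = tabulate (adj G v)

degIn≡∣∩neighbourhood∣ : (G : Graph) (S : Subset (size G)) (v : Fin (size G)) → degIn G S v ≡ ∣ S ∩ neighbourhood G v ∣
degIn≡∣∩neighbourhood∣ G S v = begin
  degIn G S v                                   ≡⟨ count-tabulate (λ u → lookup S u ∧ adj G v u) (λ u → u) ⟩
  ∣ tabulate (λ u → lookup S u ∧ adj G v u) ∣   ≡⟨ cong ∣_∣ (∩-tabulate S (adj G v)) ⟨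
  ∣ S ∩ neighbourhood G v ∣                     ∎
  where open ≡-Reasoning

degIn≤∣S∣ : (G : Graph) (S : Subset (size G)) (v : Fin (size G)) → degIn G S v ≤ ∣ S ∣
degIn≤∣S∣ G S v = ≤-trans (≤-reflexive (degIn≡∣∩neighbourhood∣ G S v)) (∣p∩q∣≤∣p∣ S _)

module _ (G : Graph) (S : Subset (size G)) where

  private
    inducedDegree : Fin (size G) → ℕ
    inducedDegree v = if lookup S v then degIn G S v else 0

  degIn≤Δind : ∀ {v} → lookup S v ≡ true → degIn G S v ≤ Δind G S
  degIn≤Δind {v} v∈S = subst (_≤ Δind G S) (cong (λ b → if b then degIn G S v else 0) v∈S)
                             (≤-maxList _ (∈-map⁺ inducedDegree (∈-allFin v)))

  Δind-≤ : ∀ {B} → (∀ {v} → lookup S v ≡ true → degIn G S v ≤ B) → Δind G S ≤ B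
  Δind-≤ {B} deg≤B = maxList-≤ _ λ y∈degrees → case-degree (∈-map⁻ inducedDegree y∈degrees)
    where
    case-degree : ∀ {y} → ∃ (λ v → v ∈ allFin (size G) × y ≡ inducedDegree v) → y ≤ B
    case-degree (v , _ , refl) with lookup S v in v∈S
    ... | true  = deg≤B v∈S
    ... | false = z≤n

  Δind≤∣S∣ : Δind G S ≤ ∣ S ∣
  Δind≤∣S∣ = Δind-≤ λ {v} _ → degIn≤∣S∣ G S v

Independent : (G : Graph) → Subset (size G) → Set
Independent G S = ∀ {u v} → lookup S u ≡ true → lookup S v ≡ true → adj G u v ≡ false

module _ (G : Graph) (S : Subset (size G)) where

  private
    nonEdge-in-S⁻ : ∀ a b c → not (a ∧ b ∧ c) ≡ true → a ≡ true → b ≡ true → c ≡ false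
    nonEdge-in-S⁻ true true false _ refl refl = refl

    nonEdge-in-S⁺ : ∀ a b c → (a ≡ true → b ≡ true → c ≡ false) → not (a ∧ b ∧ c) ≡ true
    nonEdge-in-S⁺ true  true  c c≡false = subst (λ x → not x ≡ true) (sym (c≡false refl refl)) refl
    nonEdge-in-S⁺ true  false c _       = refl
    nonEdge-in-S⁺ false b     c _       = refl

  isIndependent⇒Independent : isIndependent G S ≡ true → Independent G S
  isIndependent⇒Independent indep {u} {v} =
    nonEdge-in-S⁻ (lookup S u) (lookup S v) (adj G u v)
      (allB-true⁻ _ _ (allB-true⁻ _ _ indep (∈-allFin u)) (∈-allFin v))

  Independent⇒isIndependent : Independent G S → isIndependent G S ≡ true
  Independent⇒isIndependent indep =
    allB-true⁺ _ (allFin (size G)) λ {u} _ → allB-true⁺ _ (allFin (size G)) λ {v} _ →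
      nonEdge-in-S⁺ (lookup S u) (lookup S v) (adj G u v) indep

module _ (G : Graph) where

  private
    independent? = λ (S : Subset (size G)) → isIndependent G S Bool.≟ true
    exceedsα? = λ (S : Subset (size G)) → α G <? ∣ S ∣

  ∣S∣≤α : ∀ {S} → Independent G S → ∣ S ∣ ≤ α G
  ∣S∣≤α {S} indep = ≤-maxList _ (∈-map∘filter⁺ ∣_∣ independent?
    (S , ∈-allSubsets _ S , refl , Independent⇒isIndependent G S indep))

  α-≤ : ∀ {B} → (∀ S → Independent G S → ∣ S ∣ ≤ B) → α G ≤ B
  α-≤ {B} ∣indep∣≤B = maxList-≤ _ λ y∈sizes → case-size (∈-map∘filter⁻ ∣_∣ independent? y∈sizes)
    where
    case-size : ∀ {y} → ∃ (λ S → S ∈ allSubsets (size G) × y ≡ ∣ S ∣ × isIndependent G S ≡ true) → y ≤ B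
    case-size (S , _ , refl , indep) = ∣indep∣≤B S (isIndependent⇒Independent G S indep)

  σ≤Δind : ∀ {S} → α G < ∣ S ∣ → σ G ≤ Δind G S
  σ≤Δind {S} α<∣S∣ = minList-≤ _ (∈-map∘filter⁺ (Δind G) exceedsα? (S , ∈-allSubsets _ S , refl , α<∣S∣))

  σ-≥ : ∀ {B} → α G < size G → (∀ S → α G < ∣ S ∣ → B ≤ Δind G S) → B ≤ σ G
  σ-≥ {B} α<n B≤Δind with map (Δind G) (filter exceedsα? (allSubsets (size G))) in eq
  ... | [] = contradiction (subst (Δind G ⊤ ∈_) eq ⊤∈candidates) λ ()
    where
    ⊤∈candidates = ∈-map∘filter⁺ (Δind G) exceedsα?
      (⊤ , ∈-allSubsets _ ⊤ , refl , subst (α G <_) (sym (∣⊤∣≡n (size G))) α<n)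
  ... | x ∷ xs = ≤-minList x xs λ y∈candidates →
    case-candidate (∈-map∘filter⁻ (Δind G) exceedsα? (subst (_ ∈_) (sym eq) y∈candidates))
    where
    case-candidate : ∀ {y} → ∃ (λ S → S ∈ allSubsets (size G) × y ≡ Δind G S × α G < ∣ S ∣) → B ≤ y
    case-candidate (S , _ , refl , α<∣S∣) = B≤Δind S α<∣S∣

  -- By the convention minList [] = 0.
  σ>0⇒α<size : 0 < σ G → α G < size G
  σ>0⇒α<size σ>0 with map (Δind G) (filter exceedsα? (allSubsets (size G))) in eq
  ... | [] = contradiction σ>0 λ ()
  ... | x ∷ _ with ∈-map∘filter⁻ (Δind G) exceedsα? {xs = allSubsets (size G)} (subst (x ∈_) (sym eq) (here refl))
  ...   | S , _ , _ , α<∣S∣ = <-≤-trans α<∣S∣ (∣p∣≤n S)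

  σ≤1+α : α G < size G → σ G ≤ suc (α G)
  σ≤1+α α<n with subset-of-size α<n
  ... | T , ∣T∣≡1+α = begin
    σ G        ≤⟨ σ≤Δind {T} (≤-reflexive (sym ∣T∣≡1+α)) ⟩
    Δind G T   ≤⟨ Δind≤∣S∣ G T ⟩
    ∣ T ∣      ≡⟨ ∣T∣≡1+α ⟩
    suc (α G)  ∎
    where open ≤-Reasoning

data SplitView (m k : ℕ) : Fin (m + k) → Set where
  inˡ : ∀ i → SplitView m k (i ↑ˡ k)
  inʳ : ∀ j → SplitView m k (m ↑ʳ j)

splitView : ∀ m k (u : Fin (m + k)) → SplitView m k u
splitView m k u with splitAt m u | join-splitAt m k u
... | inj₁ i | refl = inˡ i
... | inj₂ j | refl = inʳ j

module _ (G₁ G₂ : Graph) where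

  private
    m = size G₁
    k = size G₂

  adj-∨G-ˡˡ : ∀ i i' → adj (G₁ ∨G G₂) (i ↑ˡ k) (i' ↑ˡ k) ≡ adj G₁ i i'
  adj-∨G-ˡˡ i i' rewrite splitAt-↑ˡ m i k | splitAt-↑ˡ m i' k = refl

  adj-∨G-ˡʳ : ∀ i j → adj (G₁ ∨G G₂) (i ↑ˡ k) (m ↑ʳ j) ≡ true
  adj-∨G-ˡʳ i j rewrite splitAt-↑ˡ m i k | splitAt-↑ʳ m k j = refl

  adj-∨G-ʳˡ : ∀ j i → adj (G₁ ∨G G₂) (m ↑ʳ j) (i ↑ˡ k) ≡ true
  adj-∨G-ʳˡ j i rewrite splitAt-↑ˡ m i k | splitAt-↑ʳ m k j = refl

  adj-∨G-ʳʳ : ∀ j j' → adj (G₁ ∨G G₂) (m ↑ʳ j) (m ↑ʳ j') ≡ adj G₂ j j'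
  adj-∨G-ʳʳ j j' rewrite splitAt-↑ʳ m k j | splitAt-↑ʳ m k j' = refl

  neighbourhood-∨G-ˡ : ∀ i → neighbourhood (G₁ ∨G G₂) (i ↑ˡ k) ≡ neighbourhood G₁ i ++ ⊤
  neighbourhood-∨G-ˡ i = trans (tabulate-++ m _)
    (cong₂ _++_ (tabulate-cong (adj-∨G-ˡˡ i)) (tabulate-constant (adj-∨G-ˡʳ i)))

  neighbourhood-∨G-ʳ : ∀ j → neighbourhood (G₁ ∨G G₂) (m ↑ʳ j) ≡ ⊤ ++ neighbourhood G₂ j
  neighbourhood-∨G-ʳ j = trans (tabulate-++ m _)
    (cong₂ _++_ (tabulate-constant (adj-∨G-ʳˡ j)) (tabulate-cong (adj-∨G-ʳʳ j)))

  module _ (A : Subset m) (B : Subset k) where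

    degIn-∨G-ˡ : ∀ i → degIn (G₁ ∨G G₂) (A ++ B) (i ↑ˡ k) ≡ degIn G₁ A i + ∣ B ∣
    degIn-∨G-ˡ i = begin
      degIn (G₁ ∨G G₂) (A ++ B) (i ↑ˡ k)                 ≡⟨ degIn≡∣∩neighbourhood∣ (G₁ ∨G G₂) (A ++ B) (i ↑ˡ k) ⟩
      ∣ (A ++ B) ∩ neighbourhood (G₁ ∨G G₂) (i ↑ˡ k) ∣   ≡⟨ cong (λ N → ∣ (A ++ B) ∩ N ∣) (neighbourhood-∨G-ˡ i) ⟩
      ∣ (A ++ B) ∩ (neighbourhood G₁ i ++ ⊤) ∣           ≡⟨ cong ∣_∣ (zipWith-++ _∧_ A B (neighbourhood G₁ i) ⊤) ⟩
      ∣ (A ∩ neighbourhood G₁ i) ++ (B ∩ ⊤) ∣            ≡⟨ ∣++∣ (A ∩ neighbourhood G₁ i) (B ∩ ⊤) ⟩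
      ∣ A ∩ neighbourhood G₁ i ∣ + ∣ B ∩ ⊤ ∣             ≡⟨ cong₂ _+_ (sym (degIn≡∣∩neighbourhood∣ G₁ A i)) (cong ∣_∣ (∩-identityʳ B)) ⟩
      degIn G₁ A i + ∣ B ∣                               ∎
      where open ≡-Reasoning

    degIn-∨G-ʳ : ∀ j → degIn (G₁ ∨G G₂) (A ++ B) (m ↑ʳ j) ≡ ∣ A ∣ + degIn G₂ B j
    degIn-∨G-ʳ j = begin
      degIn (G₁ ∨G G₂) (A ++ B) (m ↑ʳ j)                 ≡⟨ degIn≡∣∩neighbourhood∣ (G₁ ∨G G₂) (A ++ B) (m ↑ʳ j) ⟩
      ∣ (A ++ B) ∩ neighbourhood (G₁ ∨G G₂) (m ↑ʳ j) ∣   ≡⟨ cong (λ N → ∣ (A ++ B) ∩ N ∣) (neighbourhood-∨G-ʳ j) ⟩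
      ∣ (A ++ B) ∩ (⊤ ++ neighbourhood G₂ j) ∣           ≡⟨ cong ∣_∣ (zipWith-++ _∧_ A B ⊤ (neighbourhood G₂ j)) ⟩
      ∣ (A ∩ ⊤) ++ (B ∩ neighbourhood G₂ j) ∣            ≡⟨ ∣++∣ (A ∩ ⊤) (B ∩ neighbourhood G₂ j) ⟩
      ∣ A ∩ ⊤ ∣ + ∣ B ∩ neighbourhood G₂ j ∣             ≡⟨ cong₂ _+_ (cong ∣_∣ (∩-identityʳ A)) (sym (degIn≡∣∩neighbourhood∣ G₂ B j)) ⟩
      ∣ A ∣ + degIn G₂ B j                               ∎
      where open ≡-Reasoning

    Δind≤Δind-∨G : Δind G₂ B ≤ Δind (G₁ ∨G G₂) (A ++ B)
    Δind≤Δind-∨G = Δind-≤ G₂ B λ {j} j∈B → begin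
      degIn G₂ B j                         ≤⟨ m≤n+m _ ∣ A ∣ ⟩
      ∣ A ∣ + degIn G₂ B j                 ≡⟨ degIn-∨G-ʳ j ⟨
      degIn (G₁ ∨G G₂) (A ++ B) (m ↑ʳ j)   ≤⟨ degIn≤Δind (G₁ ∨G G₂) (A ++ B) (trans (lookup-++ʳ A B j) j∈B) ⟩
      Δind (G₁ ∨G G₂) (A ++ B)             ∎
      where open ≤-Reasoning

    ∣B∣≤Δind-∨G : ∀ {i} → lookup A i ≡ true → ∣ B ∣ ≤ Δind (G₁ ∨G G₂) (A ++ B)
    ∣B∣≤Δind-∨G {i} i∈A = begin
      ∣ B ∣                                ≤⟨ m≤n+m ∣ B ∣ _ ⟩
      degIn G₁ A i + ∣ B ∣                 ≡⟨ degIn-∨G-ˡ i ⟨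
      degIn (G₁ ∨G G₂) (A ++ B) (i ↑ˡ k)   ≤⟨ degIn≤Δind (G₁ ∨G G₂) (A ++ B) (trans (lookup-++ˡ A B i) i∈A) ⟩
      Δind (G₁ ∨G G₂) (A ++ B)             ∎
      where open ≤-Reasoning

    ∣A∣≤Δind-∨G : ∀ {j} → lookup B j ≡ true → ∣ A ∣ ≤ Δind (G₁ ∨G G₂) (A ++ B)
    ∣A∣≤Δind-∨G {j} j∈B = begin
      ∣ A ∣                                ≤⟨ m≤m+n ∣ A ∣ _ ⟩
      ∣ A ∣ + degIn G₂ B j                 ≡⟨ degIn-∨G-ʳ j ⟨
      degIn (G₁ ∨G G₂) (A ++ B) (m ↑ʳ j)   ≤⟨ degIn≤Δind (G₁ ∨G G₂) (A ++ B) (trans (lookup-++ʳ A B j) j∈B) ⟩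
      Δind (G₁ ∨G G₂) (A ++ B)             ∎
      where open ≤-Reasoning

  Independent-∨G⇒ʳ : ∀ (A : Subset m) (B : Subset k) → Independent (G₁ ∨G G₂) (A ++ B) → Independent G₂ B
  Independent-∨G⇒ʳ A B indep {j} {j'} j∈B j'∈B =
    trans (sym (adj-∨G-ʳʳ j j')) (indep (trans (lookup-++ʳ A B j) j∈B) (trans (lookup-++ʳ A B j') j'∈B))

  private
    ∉⊥ : ∀ {n} {a : Set} (j : Fin n) → lookup ⊥ j ≡ true → a
    ∉⊥ j j∈⊥ = contradiction (trans (sym (lookup-replicate j false)) j∈⊥) λ ()

  Independent-∨G-⊥ʳ : ∀ {A} → Independent G₁ A → Independent (G₁ ∨G G₂) (A ++ ⊥)
  Independent-∨G-⊥ʳ {A} indep {u} {v} u∈S v∈S with splitView m k u | splitView m k v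
  ... | inˡ i | inˡ i' = trans (adj-∨G-ˡˡ i i')
                           (indep (trans (sym (lookup-++ˡ A (⊥ {k}) i)) u∈S) (trans (sym (lookup-++ˡ A (⊥ {k}) i')) v∈S))
  ... | inˡ _ | inʳ j  = ∉⊥ j (trans (sym (lookup-++ʳ A (⊥ {k}) j)) v∈S)
  ... | inʳ j | _      = ∉⊥ j (trans (sym (lookup-++ʳ A (⊥ {k}) j)) u∈S)

  Independent-∨G-⊥ˡ : ∀ {B} → Independent G₂ B → Independent (G₁ ∨G G₂) (⊥ ++ B)
  Independent-∨G-⊥ˡ {B} indep {u} {v} u∈S v∈S with splitView m k u | splitView m k v
  ... | inʳ j | inʳ j' = trans (adj-∨G-ʳʳ j j')
                           (indep (trans (sym (lookup-++ʳ (⊥ {m}) B j)) u∈S) (trans (sym (lookup-++ʳ (⊥ {m}) B j')) v∈S))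
  ... | inʳ _ | inˡ i  = ∉⊥ i (trans (sym (lookup-++ˡ (⊥ {m}) B i)) v∈S)
  ... | inˡ i | _      = ∉⊥ i (trans (sym (lookup-++ˡ (⊥ {m}) B i)) u∈S)

  α≤α-∨G : α G₂ ≤ α (G₁ ∨G G₂)
  α≤α-∨G = α-≤ G₂ λ B indep → begin
    ∣ B ∣              ≡⟨ cong (_+ ∣ B ∣) (∣⊥∣≡0 m) ⟨
    ∣ ⊥ {m} ∣ + ∣ B ∣  ≡⟨ ∣++∣ (⊥ {m}) B ⟨
    ∣ ⊥ {m} ++ B ∣     ≤⟨ ∣S∣≤α (G₁ ∨G G₂) {⊥ ++ B} (Independent-∨G-⊥ˡ {B} indep) ⟩
    α (G₁ ∨G G₂)       ∎
    where open ≤-Reasoning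

  α-∨G≤ : α (G₁ ∨G G₂) ≤ m + α G₂
  α-∨G≤ = α-≤ (G₁ ∨G G₂) λ S indep → go S indep
    where
    go : ∀ S → Independent (G₁ ∨G G₂) S → ∣ S ∣ ≤ m + α G₂
    go S indep with Vec.splitAt m S
    ... | A , B , refl = subst (_≤ m + α G₂) (sym (∣++∣ A B))
                           (+-mono-≤ (∣p∣≤n A) (∣S∣≤α G₂ {B} (Independent-∨G⇒ʳ A B indep)))

  Δ≤Δ-∨G : Δ G₂ ≤ Δ (G₁ ∨G G₂)
  Δ≤Δ-∨G = subst (λ T → Δ G₂ ≤ Δind (G₁ ∨G G₂) T) (sym (⊤-++ m)) (Δind≤Δind-∨G ⊤ ⊤)
    where
    ⊤-++ : ∀ n → ⊤ {n + k} ≡ ⊤ {n} ++ ⊤ {k}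
    ⊤-++ zero    = refl
    ⊤-++ (suc n) = cong (true ∷_) (⊤-++ n)

Independent-emptyGraph : ∀ {m} (A : Subset m) → Independent (emptyGraph m) A
Independent-emptyGraph A _ _ = refl

double-<-cancel : ∀ {x y} → x + x < y + y → x < y
double-<-cancel x+x<y+y = ≰⇒> λ y≤x → <⇒≱ x+x<y+y (+-mono-≤ y≤x y≤x)

module _ (m : ℕ) (G : Graph) where

  private
    H = emptyGraph m ∨G G

  module _ (A : Subset m) (C : Subset (size G)) (α<∣S∣ : α H < ∣ A ++ C ∣) where

    Nonempty-G-part : Nonempty C
    Nonempty-G-part with nonempty? C
    ... | yes C-nonempty = C-nonempty
    ... | no C-empty = contradiction (∣S∣≤α H {A ++ C} A++C-independent) (<⇒≱ α<∣S∣)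
      where
      A++C-independent : Independent H (A ++ C)
      A++C-independent rewrite Empty-unique C-empty =
        Independent-∨G-⊥ʳ (emptyGraph m) G {A} (Independent-emptyGraph A)

    σ≤Δind-emptyGraph-∨G : A ≡ ⊥ → σ G ≤ Δind H (A ++ C)
    σ≤Δind-emptyGraph-∨G refl = ≤-trans (σ≤Δind G {C} αG<∣C∣) (Δind≤Δind-∨G (emptyGraph m) G ⊥ C)
      where
      αG<∣C∣ : α G < ∣ C ∣
      αG<∣C∣ = begin-strict
        α G              ≤⟨ α≤α-∨G (emptyGraph m) G ⟩
        α H              <⟨ α<∣S∣ ⟩
        ∣ ⊥ {m} ++ C ∣   ≡⟨ ∣++∣ (⊥ {m}) C ⟩
        ∣ ⊥ {m} ∣ + ∣ C ∣  ≡⟨ cong (_+ ∣ C ∣) (∣⊥∣≡0 m) ⟩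
        ∣ C ∣            ∎
        where open ≤-Reasoning

    ∣S∣≤2Δind-emptyGraph-∨G : Nonempty A → ∣ A ++ C ∣ ≤ Δind H (A ++ C) + Δind H (A ++ C)
    ∣S∣≤2Δind-emptyGraph-∨G (i , i∈A) with Nonempty-G-part
    ... | j , j∈C = begin
      ∣ A ++ C ∣           ≡⟨ ∣++∣ A C ⟩
      ∣ A ∣ + ∣ C ∣        ≤⟨ +-mono-≤ (∣A∣≤Δind-∨G (emptyGraph m) G A C ([]=⇒lookup j∈C))
                                       (∣B∣≤Δind-∨G (emptyGraph m) G A C ([]=⇒lookup i∈A)) ⟩
      Δind H (A ++ C) + Δind H (A ++ C) ∎
      where open ≤-Reasoning

  σ-emptyGraph-∨G-≥ : ∀ {B} → suc (B + B) ≤ σ G → B ≤ σ H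
  σ-emptyGraph-∨G-≥ {B} 2B<σ = σ-≥ H αH<size λ S → bound-split S
    where
    α<size : α G < size G
    α<size = σ>0⇒α<size G (≤-trans (s≤s z≤n) 2B<σ)

    αH<size : α H < m + size G
    αH<size = ≤-<-trans (α-∨G≤ (emptyGraph m) G) (+-monoʳ-< m α<size)

    B≤σ : B ≤ σ G
    B≤σ = ≤-trans (m≤m+n B B) (≤-trans (n≤1+n _) 2B<σ)

    2B<αH+1 : B + B < suc (α H)
    2B<αH+1 = ≤-trans 2B<σ (≤-trans (σ≤1+α G α<size) (s≤s (α≤α-∨G (emptyGraph m) G)))

    bound-split : ∀ S → α H < ∣ S ∣ → B ≤ Δind H S
    bound-split S with Vec.splitAt m S
    ... | A , C , refl with nonempty? A
    ...   | no A-empty = λ α<∣S∣ →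
      ≤-trans B≤σ (σ≤Δind-emptyGraph-∨G A C α<∣S∣ (Empty-unique A-empty))
    ...   | yes A-nonempty = λ α<∣S∣ → <⇒≤ (double-<-cancel
      (<-≤-trans 2B<αH+1 (≤-trans α<∣S∣ (∣S∣≤2Δind-emptyGraph-∨G A C α<∣S∣ A-nonempty))))

TendsToInfinity-transfer : ∀ {f g : ℕ → ℕ} → (∀ B → ∃ λ C → ∀ n → C ≤ f n → B ≤ g n) →
                           TendsToInfinity f → TendsToInfinity g
TendsToInfinity-transfer g-follows-f f→∞ B with g-follows-f B
... | C , C≤f⇒B≤g with f→∞ C
...   | N , C≤f = N , λ n N≤n → C≤f⇒B≤g n (C≤f n N≤n)

corollary3p17 : (m : ℕ) → 1 ≤ m → (G : ℕ → Graph) → Sensitive G →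
                  Sensitive (λ n → emptyGraph m ∨G G n)
corollary3p17 m _ G (Δ→∞ , σ→∞) =
  TendsToInfinity-transfer (λ B → B , λ n B≤Δ → ≤-trans B≤Δ (Δ≤Δ-∨G (emptyGraph m) (G n))) Δ→∞ ,
  TendsToInfinity-transfer (λ B → suc (B + B) , λ n → σ-emptyGraph-∨G-≥ m (G n)) σ→∞
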